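{- Let $\delta$ be an ordinal of uncountable cofinality, $A$ an abelian group, and $\Phi=\{\varphi_\alpha:\alpha\to A\mid\alpha<\delta\}$ a nontrivial coherent family. For $\alpha<\beta<\delta$ let $f^\Phi(\alpha,\beta)=\varphi_\beta\restriction\alpha-\varphi_\alpha$. Then $f^\Phi$ is a $1$-cocycle in $L^1(\mathcal{U}_\delta,\mathcal{D}_A)$ and $0\neq[f^\Phi]\in\mathrm{H}^1(\mathcal{U}_\delta,\mathcal{D}_A)$.
   Context: $\mathcal{U}_\delta=\{\alpha\mid\alpha<\delta\}$ is the open cover of $\delta$ (order topology) by initial segments. $\mathcal{D}_A$ is the presheaf $U\mapsto\bigoplus_UA$ of finitely supported functions with restriction maps. $L^j(\mathcal{U}_\delta,\mathcal{D}_A)=\prod_{\vec\alpha\in[\delta]^{j+1}}\mathcal{D}_A(\alpha_0)$ with $d^jf(\vec\alpha)=\sum_{i=0}^{j+1}(-1)^if(\vec\alpha^i)\restriction\alpha_0$, $\vec\alpha^i$ being $\vec\alpha$ with its $i$-th coordinate deleted; $\mathrm{H}^n(\mathcal{U}_\delta,\mathcal{D}_A)$ is the cohomology of this complex. $f=^*g$ means $f,g$ differ at finitely many points. $\Phi$ is coherent if $\varphi_\gamma\restriction\beta=^*\varphi_\beta$ for all $\beta\le\gamma<\delta$, and trivial if there is $\varphi:\delta\to A$ with $\varphi\restriction\beta=^*\varphi_\beta$ for all $\beta<\delta$; nontrivial means not trivial. -}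

module Defs where

open import Level using (Level; _⊔_; 0ℓ) renaming (suc to lsuc)
open import Data.Nat using (ℕ)
open import Data.Maybe using (Maybe; just; nothing)
open import Data.Product using (Σ; ∃; _×_; _,_)
open import Data.Sum using (_⊎_)
open import Data.List using (List)
open import Data.List.Membership.Propositional using (_∉_)
open import Relation.Binary.Core using (Rel)
open import Relation.Binary.Structures using (IsStrictTotalOrder)
open import Relation.Binary.PropositionalEquality using (_≡_)
open import Induction.WellFounded using (WellFounded)
open import Relation.Nullary using (¬_)
open import Algebra.Bundles using (AbelianGroup)

-- An ordinal δ, presented (up to isomorphism) as a well-ordered set:
-- the elements of δ are the ordinals α < δ, and α itself is identified
-- with the set {ξ ∈ δ ∣ ξ < α}.
record Ordinal : Set₁ where
  field
    Carrier       : Set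
    _<_           : Rel Carrier 0ℓ
    isStrictTotal : IsStrictTotalOrder _≡_ _<_
    wellFounded   : WellFounded _<_

-- Uncountable cofinality: every countable subset of δ (enumerated by a
-- map ℕ → Maybe δ, so that empty and finite subsets are included) is
-- bounded strictly below δ.  (Classically equivalent to cf(δ) > ω.)
UncountableCofinality : Ordinal → Set
UncountableCofinality δ =
  (s : ℕ → Maybe Carrier) →
  ∃ λ β → ∀ n ξ → s n ≡ just ξ → ξ < β
  where open Ordinal δ

module _ {c ℓ : Level} (δ : Ordinal) (A : AbelianGroup c ℓ) where
  open Ordinal δ renaming (Carrier to D)
  open AbelianGroup A renaming (Carrier to G)

  -- A function α → A is represented by a function D → G, of which only
  -- the values at ξ < α are relevant.
  -- Equality of the restrictions to α:
  EqOn : D → (D → G) → (D → G) → Set ℓ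
  EqOn α h h' = ∀ ξ → ξ < α → h ξ ≈ h' ξ

  AlmostEqOn : D → (D → G) → (D → G) → Set ℓ
  AlmostEqOn α h h' =
    Σ (List D) λ L → ∀ ξ → ξ < α → ξ ∉ L → h ξ ≈ h' ξ

  -- h ↾ α ∈ D_A(α) = ⊕_α A  (finitely supported)
  FinSupp : D → (D → G) → Set ℓ
  FinSupp α h = AlmostEqOn α h (λ _ → ε)

  _≤o_ : D → D → Set
  β ≤o γ = β < γ ⊎ β ≡ γ

  Family : Set c
  Family = D → D → G

  Coherent : Family → Set ℓ
  Coherent φ = ∀ β γ → β ≤o γ → AlmostEqOn β (φ γ) (φ β)

  Trivial : Family → Set (c ⊔ ℓ)
  Trivial φ = Σ (D → G) λ ψ → ∀ β → AlmostEqOn β ψ (φ β)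

  Nontrivial : Family → Set (c ⊔ ℓ)
  Nontrivial φ = ¬ Trivial φ

  -- Cochains of the complex L^•(U_δ, D_A) in degrees 0, 1, 2.
  -- L^0 = ∏_{α<δ} D_A(α)
  C0 : Set c
  C0 = D → D → G
  IsL0 : C0 → Set ℓ
  IsL0 g = ∀ α → FinSupp α (g α)

  -- L^1 = ∏_{α<β<δ} D_A(α); a 1-cochain f(α,β) ∈ D_A(α)
  C1 : Set c
  C1 = D → D → D → G
  IsL1 : C1 → Set ℓ
  IsL1 f = ∀ α β → α < β → FinSupp α (f α β)

  C2 : Set c
  C2 = D → D → D → D → G

  _≈L1_ : C1 → C1 → Set ℓ
  f ≈L1 f' = ∀ α β → α < β → EqOn α (f α β) (f' α β)

  _≈L2_ : C2 → C2 → Set ℓ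
  h ≈L2 h' = ∀ α β γ → α < β → β < γ → EqOn α (h α β γ) (h' α β γ)

  d0 : C0 → C1
  d0 g α β ξ = g β ξ - g α ξ

  d1 : C1 → C2
  d1 f α β γ ξ = (f β γ ξ - f α γ ξ) ∙ f α β ξ

  zero2 : C2
  zero2 _ _ _ _ = ε

  IsCocycle1 : C1 → Set ℓ
  IsCocycle1 f = IsL1 f × (d1 f ≈L2 zero2)

  IsCoboundary1 : C1 → Set (c ⊔ ℓ)
  IsCoboundary1 f = Σ C0 λ g → IsL0 g × (d0 g ≈L1 f)

  fΦ : Family → C1
  fΦ φ α β ξ = φ β ξ - φ α ξ

-- Formally f^Φ = d⁰Φ, so d¹f^Φ = d¹d⁰Φ = 0; that f^Φ lies in L¹ is exactly
-- coherence.  If f^Φ = d⁰g with g ∈ L⁰, then h = Φ − g satisfies d⁰h = 0,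
-- i.e. the h_α agree exactly on common domains, so they glue to a single
-- ψ : δ → A.  Since g_β is finitely supported, ψ↾β = φ_β − g_β =* φ_β, and
-- Φ would be trivial.
module Submission where

open import Defs
open import Data.Product using (∃; Σ; _×_; _,_; proj₁; proj₂)
open import Data.Maybe using (just)
open import Data.Sum using (inj₁)
open import Relation.Nullary using (¬_)
import Relation.Binary.PropositionalEquality as ≡
open import Relation.Binary.Structures using (IsStrictTotalOrder)
open import Relation.Binary.Definitions using (tri<; tri≈; tri>)
open import Algebra.Bundles using (AbelianGroup)
import Algebra.Properties.AbelianGroup as AbelianGroupProperties
import Algebra.Solver.CommutativeMonoid as CommutativeMonoidSolver
import Relation.Binary.Reasoning.Setoid as SetoidReasoning

module AbelianGroupIdentities {c ℓ} (A : AbelianGroup c ℓ) where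
  open AbelianGroup A
  open AbelianGroupProperties A
  open SetoidReasoning setoid

  -‿interchange : ∀ a b c d → (a - b) - (c - d) ≈ (a - c) - (b - d)
  -‿interchange a b c d = begin
    (a - b) - (c - d)        ≈⟨ ∙-congˡ (⁻¹-anti-homo‿- c d) ⟩
    (a ∙ b ⁻¹) ∙ (d ∙ c ⁻¹)  ≈⟨ solve 4 (λ a b′ c′ d → (a ⊕ b′) ⊕ (d ⊕ c′) ⊜ (a ⊕ c′) ⊕ (d ⊕ b′))
                                      refl a (b ⁻¹) (c ⁻¹) d ⟩
    (a ∙ c ⁻¹) ∙ (d ∙ b ⁻¹)  ≈⟨ ∙-congˡ (⁻¹-anti-homo‿- b d) ⟨
    (a - c) - (b - d)        ∎
    where open CommutativeMonoidSolver commutativeMonoid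

  -‿cocycle : ∀ x y z → ((z - y) - (z - x)) ∙ (y - x) ≈ ε
  -‿cocycle x y z = begin
    ((z - y) - (z - x)) ∙ (y - x)  ≈⟨ ∙-congʳ (-‿interchange z y z x) ⟩
    ((z - z) - (y - x)) ∙ (y - x)  ≈⟨ ∙-congʳ (∙-congʳ (inverseʳ z)) ⟩
    (ε - (y - x)) ∙ (y - x)        ≈⟨ ∙-congʳ (identityˡ _) ⟩
    (y - x) ⁻¹ ∙ (y - x)           ≈⟨ inverseˡ _ ⟩
    ε                              ∎

  x-y≈u-v⇒u-x≈v-y : ∀ {x y u v} → x - y ≈ u - v → u - x ≈ v - y
  x-y≈u-v⇒u-x≈v-y {x} {y} {u} {v} x-y≈u-v = x∙y⁻¹≈ε⇒x≈y _ _ (begin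
    (u - x) - (v - y)  ≈⟨ -‿interchange u x v y ⟩
    (u - v) - (x - y)  ≈⟨ x≈y⇒x∙y⁻¹≈ε (sym x-y≈u-v) ⟩
    ε                  ∎)

  y≈ε⇒x-y≈x : ∀ {x y} → y ≈ ε → x - y ≈ x
  y≈ε⇒x-y≈x {x} {y} y≈ε = begin
    x - y     ≈⟨ ∙-congˡ (⁻¹-cong y≈ε) ⟩
    x ∙ ε ⁻¹  ≈⟨ ∙-congˡ ε⁻¹≈ε ⟩
    x ∙ ε     ≈⟨ identityʳ x ⟩
    x         ∎

module _ (δ : Ordinal) where
  open Ordinal δ

  NoMaximum : Set
  NoMaximum = ∀ ξ → ∃ λ β → ξ < β

  uncountableCofinality⇒noMaximum : UncountableCofinality δ → NoMaximum
  uncountableCofinality⇒noMaximum ucf ξ =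
    let β , bound = ucf (λ _ → just ξ) in β , bound 0 ξ ≡.refl

module _ {c ℓ} (δ : Ordinal) (A : AbelianGroup c ℓ) where
  open Ordinal δ renaming (Carrier to D)
  open AbelianGroup A renaming (Carrier to G)
  open AbelianGroupProperties A using (x≈y⇒x∙y⁻¹≈ε)
  open AbelianGroupIdentities A

  d1∘d0≈0 : ∀ g → _≈L2_ δ A (d1 δ A (d0 δ A g)) (zero2 δ A)
  d1∘d0≈0 g α β γ _ _ ξ _ = -‿cocycle (g α ξ) (g β ξ) (g γ ξ)

  coherent⇒fΦ-isL1 : ∀ φ → Coherent δ A φ → IsL1 δ A (fΦ δ A φ)
  coherent⇒fΦ-isL1 φ coh α β α<β =
    let L , agree = coh α β (inj₁ α<β)
    in L , λ ξ ξ<α ξ∉L → x≈y⇒x∙y⁻¹≈ε (agree ξ ξ<α ξ∉L)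

  StrictlyCoherent : Family δ A → Set ℓ
  StrictlyCoherent h = ∀ α β → α < β → EqOn δ A α (h β) (h α)

  strictlyCoherent-indexIndependent : ∀ h → StrictlyCoherent h →
    ∀ {α β ξ} → ξ < α → ξ < β → h α ξ ≈ h β ξ
  strictlyCoherent-indexIndependent h coh {α} {β} ξ<α ξ<β
    with IsStrictTotalOrder.compare isStrictTotal α β
  ... | tri< α<β _ _ = sym (coh α β α<β _ ξ<α)
  ... | tri≈ _ ≡.refl _ = refl
  ... | tri> _ _ β<α = coh β α β<α _ ξ<β

  strictlyCoherent⇒glues : NoMaximum δ → ∀ h → StrictlyCoherent h →
    Σ (D → G) λ ψ → ∀ β → EqOn δ A β ψ (h β)
  strictlyCoherent⇒glues above h coh =
    (λ ξ → h (proj₁ (above ξ)) ξ) ,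
    λ β ξ ξ<β → strictlyCoherent-indexIndependent h coh (proj₂ (above ξ)) ξ<β

  fΦ-coboundary⇒trivial : NoMaximum δ → ∀ φ → IsCoboundary1 δ A (fΦ δ A φ) → Trivial δ A φ
  fΦ-coboundary⇒trivial above φ (g , g∈L0 , d0g≈fΦ) = ψ , ψ≈*φ
    where
    h : Family δ A
    h α ξ = φ α ξ - g α ξ

    h-strictlyCoherent : StrictlyCoherent h
    h-strictlyCoherent α β α<β ξ ξ<α = x-y≈u-v⇒u-x≈v-y (d0g≈fΦ α β α<β ξ ξ<α)

    glued : Σ (D → G) λ ψ → ∀ β → EqOn δ A β ψ (h β)
    glued = strictlyCoherent⇒glues above h h-strictlyCoherent

    ψ : D → G
    ψ = proj₁ glued

    ψ≈*φ : ∀ β → AlmostEqOn δ A β ψ (φ β)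
    ψ≈*φ β =
      let L , g≈ε = g∈L0 β
      in L , λ ξ ξ<β ξ∉L → trans (proj₂ glued β ξ ξ<β) (y≈ε⇒x-y≈x (g≈ε ξ ξ<β ξ∉L))

lemma2p19 : ∀ {c ℓ} (δ : Ordinal) → UncountableCofinality δ →
    (A : AbelianGroup c ℓ) (φ : Family δ A) →
    Coherent δ A φ → Nontrivial δ A φ →
    IsCocycle1 δ A (fΦ δ A φ) × ¬ IsCoboundary1 δ A (fΦ δ A φ)
lemma2p19 δ ucf A φ coh nontrivial =
  (coherent⇒fΦ-isL1 δ A φ coh , d1∘d0≈0 δ A φ) ,
  λ coboundary → nontrivial
    (fΦ-coboundary⇒trivial δ A (uncountableCofinality⇒noMaximum δ ucf) φ coboundary)
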